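{- Let $t$ be a commuting indeterminate and extend $\partial$ $t$-linearly to $\mathbf{WSym}[t]$. Let $T:\mathbf{WSym}[t]\to\mathbf{WSym}[t]$ be the linear map $T(x)=t\,x\,\Phi_{\{\{1\}\}}+\partial(x)$, and for $n,k\ge0$ let $\mathfrak B_{n,k}$ be the coefficient of $t^k$ in $T^n(1)$. Then $$\mathfrak B_{n,k}=\sum_{\pi}\Phi_\pi,$$ where the sum is over all set partitions $\pi$ of $\{1,\dots,n\}$ having exactly $k$ blocks.
   Context: $\mathbf{WSym}$ is the algebra with basis $(\Phi_\pi)$ indexed by set partitions $\pi$ of $\{1,\dots,n\}$, $n\ge0$ ($\Phi_\emptyset=1$), with product $\Phi_\pi\Phi_{\pi'}=\Phi_{\pi\cup\pi'[n]}$ when $\pi$ is a partition of $\{1,\dots,n\}$, where $\pi'[n]$ adds $n$ to each element of each block of $\pi'$. $\partial:\mathbf{WSym}\to\mathbf{WSym}$ is the linear map with $\partial(1)=0$ and, for a set partition $\pi=\{\pi_1,\dots,\pi_k\}$ of $\{1,\dots,n\}$, $n\ge1$, $\partial(\Phi_\pi)=\sum_{i=1}^k\Phi_{(\pi\setminus\{\pi_i\})\cup\{\pi_i\cup\{n+1\}\}}$. -}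

module Defs where

open import Data.Nat as ℕ using (ℕ; zero; suc; _+_; _<_)
open import Data.Integer as ℤ using (ℤ)
open import Data.List using (List; []; _∷_; _++_; map; concat; length; upTo)
open import Data.Nat.ListAction using (sum)
open import Data.List.Properties using (≡-dec)
open import Data.List.Relation.Unary.All using (All)
open import Data.List.Relation.Unary.Linked using (Linked)
open import Data.List.Relation.Binary.Permutation.Propositional using (_↭_)
open import Data.Product using (_×_; _,_)
open import Data.Empty using (⊥)
open import Relation.Binary.PropositionalEquality using (_≡_; _≢_)
open import Relation.Nullary using (yes; no)

-- A set partition of {1,…,n} is encoded canonically as a list of blocks
-- (each block a list of naturals): every block nonempty and strictly
-- increasing, blocks listed by strictly increasing minimum, and the
-- concatenation of the blocks is a permutation of [1,…,n] (so blocks are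
-- pairwise disjoint with union {1,…,n}).  Each set partition has exactly
-- one such encoding.

Blocks : Set
Blocks = List (List ℕ)

range1 : ℕ → List ℕ
range1 n = map suc (upTo n)

_≺_ : List ℕ → List ℕ → Set
(x ∷ _) ≺ (y ∷ _) = x < y
_       ≺ _       = ⊥

IsSetPartition : ℕ → Blocks → Set
IsSetPartition n π =
  All (λ b → b ≢ []) π ×
  All (Linked _<_) π ×
  Linked _≺_ π ×
  (concat π ↭ range1 n)

-- the n with π a partition of {1,…,n}
size : Blocks → ℕ
size π = sum (map length π)

-- WSym[t] with integer coefficients: formal finite sums of terms
-- c · t^k · Φ_π, represented as lists of (c , k , π).

Term : Set
Term = ℤ × ℕ × Blocks

WSymT : Set
WSymT = List Term

one : WSymT
one = (ℤ.+ 1 , 0 , []) ∷ []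

shift : ℕ → Blocks → Blocks
shift n π' = map (map (n +_)) π'

-- Φ_π Φ_π' = Φ_{π ∪ π'[n]}
mulΦ : Blocks → Blocks → Blocks
mulΦ π π' = π ++ shift (size π) π'

mulRight : WSymT → Blocks → WSymT
mulRight x σ = map (λ { (c , k , π) → (c , k , mulΦ π σ) }) x

mulT : WSymT → WSymT
mulT x = map (λ { (c , k , π) → (c , suc k , π) }) x

addToEachBlock : ℕ → Blocks → List Blocks
addToEachBlock m []       = []
addToEachBlock m (b ∷ bs) = ((b ++ (m ∷ [])) ∷ bs) ∷ map (λ bs' → b ∷ bs') (addToEachBlock m bs)

-- ∂(Φ_π) = Σ_i Φ_{(π ∖ {π_i}) ∪ {π_i ∪ {n+1}}}   (∂(1) = 0)
∂Φ : Blocks → List Blocks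
∂Φ π = addToEachBlock (suc (size π)) π

∂ : WSymT → WSymT
∂ [] = []
∂ ((c , k , π) ∷ x) = map (λ π' → (c , k , π')) (∂Φ π) ++ ∂ x

Φ₁ : Blocks
Φ₁ = (1 ∷ []) ∷ []

T : WSymT → WSymT
T x = mulT (mulRight x Φ₁) ++ ∂ x

T^_ : ℕ → WSymT → WSymT
(T^ zero) x = x
(T^ suc n) x = T ((T^ n) x)

coeff : WSymT → ℕ → Blocks → ℤ
coeff [] k π = ℤ.0ℤ
coeff ((c , j , σ) ∷ x) k π with j ℕ.≟ k | ≡-dec (≡-dec ℕ._≟_) σ π
... | yes _ | yes _ = c ℤ.+ coeff x k π
... | _     | _     = coeff x k π

-- 𝔅_{n,k}: coefficient of t^k in T^n(1), as a function from Φ-basis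
-- indices to its coefficients
𝔅coeff : ℕ → ℕ → Blocks → ℤ
𝔅coeff n k π = coeff ((T^ n) one) k π

module Submission where

open import Defs
open import Data.Nat using (ℕ)
open import Data.Integer using (0ℤ; 1ℤ)
open import Data.List using (length)
open import Data.Product using (_×_)
open import Relation.Nullary using (¬_)
open import Relation.Binary.PropositionalEquality using (_≡_)

open import Data.Nat as ℕ using (zero; suc; _<_; _≤_; s≤s)
open import Data.Nat.Properties using (+-comm; 1+n≢n; <-irrefl; <-≤-trans)
import Data.Integer as ℤ
open import Data.List using (List; []; _∷_; [_]; _++_; _∷ʳ_; map; concat; concatMap; upTo)
open import Data.List.Properties
  using (≡-dec; ∷-injectiveˡ; ∷-injectiveʳ; ∷ʳ-injectiveˡ; ++-assoc; ++-conicalˡ; ++-conicalʳ;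
         map-++; map-cong-local; concatMap-cong; length-++; length-map; length-upTo; upTo-∷ʳ)
open import Data.List.Relation.Unary.All as All using (All; []; _∷_)
open import Data.List.Relation.Unary.All.Properties using (++⁻ˡ; ++⁻ʳ; map⁺)
open import Data.List.Relation.Unary.Any as Any using (here; there)
open import Data.List.Relation.Unary.Linked as Linked using (Linked; []; [-]; _∷_)
open import Data.List.Relation.Unary.AllPairs using ([]; _∷_)
open import Data.List.Relation.Unary.Unique.Propositional using (Unique)
import Data.List.Relation.Unary.Unique.Propositional.Properties as Uniqueₚ
open import Data.List.Relation.Binary.Permutation.Propositional
  using (_↭_; ↭-refl; ↭-prep; ↭-sym; ↭-trans; ↭-reflexive; ↭⇒↭ₛ; module PermutationReasoning)
open import Data.List.Relation.Binary.Permutation.Propositional.Properties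
  using (All-resp-↭; ∈-resp-↭; ++⁺ˡ; shifts; drop-∷; ∷↭∷ʳ; ↭-length; ↭-empty-inv)
  renaming (shift to ↭-shift)
open import Data.List.Relation.Binary.Permutation.Setoid.Properties using (Unique-resp-↭)
open import Data.List.Membership.Propositional using (_∈_; _∉_; find; lose)
open import Data.List.Membership.Propositional.Properties
  using (∈-map⁺; ∈-map⁻; ∈-++⁺ˡ; ∈-++⁺ʳ; ∈-++⁻; ∈-upTo⁻; ∈-concatMap⁺; ∈-concatMap⁻)
open import Data.Product as Product using (∃-syntax; _,_)
open import Data.Sum using (inj₁; inj₂)
open import Data.Empty using (⊥-elim)
open import Relation.Nullary using (yes; no)
open import Relation.Binary.PropositionalEquality
  using (_≢_; refl; sym; trans; cong; cong₂; subst; setoid; module ≡-Reasoning)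
open import Function using (_∘_)

-- By induction T^n(1) is the sum of t^{|σ|} Φ_σ over a list of partitions built from
-- the empty one: each σ of {1,…,n} contributes t Φ_σ Φ_{{1}}, which adds {n+1} as a
-- new last block (and one to the block count), and ∂Φ_σ, which adds n+1 to one of the
-- blocks.  Conversely, in a partition of {1,…,n+1} in canonical form the maximum n+1
-- is the last entry of its block, and a singleton {n+1} is the last block; deleting it
-- recovers the unique σ it came from.  So the list contains every set partition of
-- {1,…,n} exactly once, and the coefficient of t^k Φ_π is 1 or 0 accordingly.

length-∷ʳ : ∀ {A : Set} (xs : List A) {x} → length (xs ∷ʳ x) ≡ suc (length xs)
length-∷ʳ xs = trans (length-++ xs) (+-comm (length xs) 1)

∷ʳ≢[] : ∀ {A : Set} (xs : List A) {x} → xs ∷ʳ x ≢ []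
∷ʳ≢[] xs eq with () ← ++-conicalʳ xs _ eq

linked-∷ʳ⁺ : ∀ {A : Set} {R : A → A → Set} {xs y} →
             Linked R xs → All (λ x → R x y) xs → Linked R (xs ∷ʳ y)
linked-∷ʳ⁺ []         _           = [-]
linked-∷ʳ⁺ [-]        (Rxy ∷ [])  = Rxy ∷ [-]
linked-∷ʳ⁺ (Rxx′ ∷ l) (_ ∷ Rxsy)  = Rxx′ ∷ linked-∷ʳ⁺ l Rxsy

linked-∷ʳ⁻ : ∀ {A : Set} {R : A → A → Set} xs {y} → Linked R (xs ∷ʳ y) → Linked R xs
linked-∷ʳ⁻ []           _          = []
linked-∷ʳ⁻ (_ ∷ [])     _          = [-]
linked-∷ʳ⁻ (_ ∷ x ∷ xs) (Rxx′ ∷ l) = Rxx′ ∷ linked-∷ʳ⁻ (x ∷ xs) l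

map++concatMap↭ : ∀ {A B : Set} (f : A → B) (g : A → List B) xs →
                  map f xs ++ concatMap g xs ↭ concatMap (λ x → f x ∷ g x) xs
map++concatMap↭ f g []       = ↭-refl
map++concatMap↭ f g (x ∷ xs) =
  ↭-prep (f x) (↭-trans (shifts (map f xs) (g x)) (++⁺ˡ (g x) (map++concatMap↭ f g xs)))

unique-concatMap⁺ : ∀ {A B : Set} (f : A → List B) {xs} → Unique xs → (∀ x → Unique (f x)) →
                    (∀ {x x′ y} → x ∈ xs → x′ ∈ xs → y ∈ f x → y ∈ f x′ → x ≡ x′) →
                    Unique (concatMap f xs)
unique-concatMap⁺ f {[]}     _            _  _   = []
unique-concatMap⁺ f {x ∷ xs} (x∉xs ∷ xs!) f! src =
  Uniqueₚ.++⁺ (f! x) (unique-concatMap⁺ f xs! f! λ x∈ x′∈ → src (there x∈) (there x′∈)) disjoint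
  where
  disjoint : ∀ {y} → ¬ (y ∈ f x × y ∈ concatMap f xs)
  disjoint (y∈fx , y∈) with x′ , x′∈ , y∈fx′ ← find (∈-concatMap⁻ f y∈) =
    All.lookup x∉xs x′∈ (src (here refl) (there x′∈) y∈fx y∈fx′)

-- T^n(1) as a sum of monomials

monomial : Blocks → Term
monomial σ = (1ℤ , length σ , σ)

coeff-monomials-∉ : ∀ L {k π} → ¬ (π ∈ L × length π ≡ k) → coeff (map monomial L) k π ≡ 0ℤ
coeff-monomials-∉ []      π∉ = refl
coeff-monomials-∉ (σ ∷ L) {k} {π} π∉ with length σ ℕ.≟ k | ≡-dec (≡-dec ℕ._≟_) σ π
... | yes |σ|≡k | yes refl = ⊥-elim (π∉ (here refl , |σ|≡k))
... | yes _     | no _     = coeff-monomials-∉ L (π∉ ∘ Product.map₁ there)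
... | no _      | _        = coeff-monomials-∉ L (π∉ ∘ Product.map₁ there)

coeff-monomials-∈ : ∀ {L π} → Unique L → π ∈ L → coeff (map monomial L) (length π) π ≡ 1ℤ
coeff-monomials-∈ {σ ∷ L} {π} (σ∉L ∷ L!) π∈ with length σ ℕ.≟ length π | ≡-dec (≡-dec ℕ._≟_) σ π
... | yes _ | yes refl =
  cong (λ c → 1ℤ ℤ.+ c) (coeff-monomials-∉ L λ (σ∈L , _) → All.lookup σ∉L σ∈L refl)
... | no ≢  | yes refl = ⊥-elim (≢ refl)
... | yes _ | no σ≢π   = coeff-monomials-∈ L! (Any.tail (σ≢π ∘ sym) π∈)
... | no _  | no σ≢π   = coeff-monomials-∈ L! (Any.tail (σ≢π ∘ sym) π∈)

length-addToEachBlock : ∀ m σ {π} → π ∈ addToEachBlock m σ → length π ≡ length σ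
length-addToEachBlock m (b ∷ bs) (here refl) = refl
length-addToEachBlock m (b ∷ bs) (there π∈) with _ , π′∈ , refl ← ∈-map⁻ (b ∷_) π∈ =
  cong suc (length-addToEachBlock m bs π′∈)

setPartitions : ℕ → List Blocks
setPartitions zero    = [ [] ]
setPartitions (suc n) = map (λ σ → mulΦ σ Φ₁) (setPartitions n) ++ concatMap ∂Φ (setPartitions n)

T-monomials : ∀ L → T (map monomial L) ≡ map monomial (map (λ σ → mulΦ σ Φ₁) L ++ concatMap ∂Φ L)
T-monomials L =
  trans (cong₂ _++_ (newBlock L) (∂-monomials L)) (sym (map-++ monomial _ (concatMap ∂Φ L)))
  where
  newBlock : ∀ L → mulT (mulRight (map monomial L) Φ₁) ≡ map monomial (map (λ σ → mulΦ σ Φ₁) L)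
  newBlock []      = refl
  newBlock (σ ∷ L) = cong₂ _∷_ (cong (λ k → (1ℤ , k , mulΦ σ Φ₁)) (sym (length-∷ʳ σ))) (newBlock L)

  ∂Φ-monomials : ∀ σ → map (λ π → (1ℤ , length σ , π)) (∂Φ σ) ≡ map monomial (∂Φ σ)
  ∂Φ-monomials σ = map-cong-local (All.tabulate λ {π} π∈ →
    cong (λ k → (1ℤ , k , π)) (sym (length-addToEachBlock _ σ π∈)))

  ∂-monomials : ∀ L → ∂ (map monomial L) ≡ map monomial (concatMap ∂Φ L)
  ∂-monomials []      = refl
  ∂-monomials (σ ∷ L) = trans (cong₂ _++_ (∂Φ-monomials σ) (∂-monomials L))
                              (sym (map-++ monomial (∂Φ σ) (concatMap ∂Φ L)))

T^n-one : ∀ n → (T^ n) one ≡ map monomial (setPartitions n)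
T^n-one zero    = refl
T^n-one (suc n) = trans (cong T (T^n-one n)) (T-monomials (setPartitions n))

-- Inserting a new maximum into a partition

data Insert (m : ℕ) : Blocks → Blocks → Set where
  new  : Insert m [] [ [ m ] ]
  join : ∀ {b bs} → Insert m (b ∷ bs) ((b ∷ʳ m) ∷ bs)
  skip : ∀ {b bs π} → Insert m bs π → Insert m (b ∷ bs) (b ∷ π)

insertions : ℕ → Blocks → List Blocks
insertions m σ = (σ ∷ʳ [ m ]) ∷ addToEachBlock m σ

insert-new : ∀ m σ → Insert m σ (σ ∷ʳ [ m ])
insert-new m []       = new
insert-new m (b ∷ bs) = skip (insert-new m bs)

∈addToEachBlock⇒Insert : ∀ m σ {π} → π ∈ addToEachBlock m σ → Insert m σ π
∈addToEachBlock⇒Insert m (b ∷ bs) (here refl) = join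
∈addToEachBlock⇒Insert m (b ∷ bs) (there π∈) with _ , π′∈ , refl ← ∈-map⁻ (b ∷_) π∈ =
  skip (∈addToEachBlock⇒Insert m bs π′∈)

∈insertions⇒Insert : ∀ {m σ π} → π ∈ insertions m σ → Insert m σ π
∈insertions⇒Insert (here refl) = insert-new _ _
∈insertions⇒Insert (there π∈)  = ∈addToEachBlock⇒Insert _ _ π∈

Insert⇒∈insertions : ∀ {m σ π} → Insert m σ π → π ∈ insertions m σ
Insert⇒∈insertions new  = here refl
Insert⇒∈insertions join = there (here refl)
Insert⇒∈insertions {σ = b ∷ _} (skip i) with Insert⇒∈insertions i
... | here refl = here refl
... | there π∈  = there (there (∈-map⁺ (b ∷_) π∈))

addToEachBlock-unique : ∀ m σ → Unique (addToEachBlock m σ)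
addToEachBlock-unique m []       = []
addToEachBlock-unique m (b ∷ bs) =
  All.tabulate join≢skip ∷ Uniqueₚ.map⁺ ∷-injectiveʳ (addToEachBlock-unique m bs)
  where
  join≢skip : ∀ {π} → π ∈ map (b ∷_) (addToEachBlock m bs) → (b ∷ʳ m) ∷ bs ≢ π
  join≢skip π∈ eq with _ , _ , π≡b∷_ ← ∈-map⁻ (b ∷_) π∈ =
    1+n≢n (trans (sym (length-∷ʳ b)) (cong length (∷-injectiveˡ (trans eq π≡b∷_))))

insertions-unique : ∀ m σ → Unique (insertions m σ)
insertions-unique m σ = All.tabulate new≢added ∷ addToEachBlock-unique m σ
  where
  new≢added : ∀ {π} → π ∈ addToEachBlock m σ → σ ∷ʳ [ m ] ≢ π
  new≢added π∈ eq =
    1+n≢n (trans (sym (length-∷ʳ σ)) (trans (cong length eq) (length-addToEachBlock m σ π∈)))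

-- Insertion never changes the minimum of an existing block.
≺-Insert⁺ : ∀ {m b c cs π} → b ≺ c → Insert m (c ∷ cs) π → Linked _≺_ π → Linked _≺_ (b ∷ π)
≺-Insert⁺ {b = []}                    ()
≺-Insert⁺ {b = _ ∷ _} {c = []}        ()
≺-Insert⁺ {b = _ ∷ _} {c = _ ∷ _} b≺c join     l = b≺c ∷ l
≺-Insert⁺ {b = _ ∷ _} {c = _ ∷ _} b≺c (skip _) l = b≺c ∷ l

≺-Insert⁻ : ∀ {m b c cs π} → c ≢ [] → Insert m (c ∷ cs) π → Linked _≺_ (b ∷ π) → b ≺ c
≺-Insert⁻ {c = []} c≢[] _ _ = ⊥-elim (c≢[] refl)
≺-Insert⁻ {b = []}    {c = _ ∷ _} _ join     (() ∷ _)
≺-Insert⁻ {b = []}    {c = _ ∷ _} _ (skip _) (() ∷ _)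
≺-Insert⁻ {b = _ ∷ _} {c = _ ∷ _} _ join     (b≺c ∷ _) = b≺c
≺-Insert⁻ {b = _ ∷ _} {c = _ ∷ _} _ (skip _) (b≺c ∷ _) = b≺c

Insert-nonempty : ∀ {m σ π} → All (_≢ []) σ → Insert m σ π → All (_≢ []) π
Insert-nonempty _           new        = (λ ()) ∷ []
Insert-nonempty (_ ∷ ne)    (join {b}) = ∷ʳ≢[] b ∷ ne
Insert-nonempty (b≢[] ∷ ne) (skip i)   = b≢[] ∷ Insert-nonempty ne i

Insert-increasing : ∀ {m σ π} → All (Linked _<_) σ → All (_< m) (concat σ) → Insert m σ π →
                    All (Linked _<_) π
Insert-increasing _          _  new          = [-] ∷ []
Insert-increasing (b↑ ∷ bs↑) bd (join {b})   = linked-∷ʳ⁺ b↑ (++⁻ˡ b bd) ∷ bs↑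
Insert-increasing (b↑ ∷ bs↑) bd (skip {b} i) = b↑ ∷ Insert-increasing bs↑ (++⁻ʳ b bd) i

Insert⁻-increasing : ∀ {m σ π} → Insert m σ π → All (Linked _<_) π → All (Linked _<_) σ
Insert⁻-increasing new        _          = []
Insert⁻-increasing (join {b}) (b↑ ∷ bs↑) = linked-∷ʳ⁻ b b↑ ∷ bs↑
Insert⁻-increasing (skip i)   (b↑ ∷ π↑)  = b↑ ∷ Insert⁻-increasing i π↑

Insert-ordered : ∀ {m σ π} → All (_≢ []) σ → All (_< m) (concat σ) → Insert m σ π →
                 Linked _≺_ σ → Linked _≺_ π
Insert-ordered _          _         new                            _         = [-]
Insert-ordered (b≢[] ∷ _) _         (join {[]})                    _         = ⊥-elim (b≢[] refl)
Insert-ordered _          _         (join {_ ∷ _} {[]})            _         = [-]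
Insert-ordered _          _         (join {_ ∷ _} {[] ∷ _})        (() ∷ _)
Insert-ordered _          _         (join {_ ∷ _} {(_ ∷ _) ∷ _})   (b≺c ∷ l) = b≺c ∷ l
Insert-ordered (b≢[] ∷ _) _         (skip {[]} new)                _         = ⊥-elim (b≢[] refl)
Insert-ordered _          (x<m ∷ _) (skip {_ ∷ _} new)             _         = x<m ∷ [-]
Insert-ordered (_ ∷ ne)   bd        (skip {b} i)                   (b≺c ∷ l) =
  ≺-Insert⁺ b≺c i (Insert-ordered ne (++⁻ʳ b bd) i l)

Insert⁻-ordered : ∀ {m σ π} → All (_≢ []) σ → Insert m σ π → Linked _≺_ π → Linked _≺_ σ
Insert⁻-ordered _          new                          _         = []
Insert⁻-ordered (b≢[] ∷ _) (join {[]})                  _         = ⊥-elim (b≢[] refl)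
Insert⁻-ordered _          (join {_ ∷ _} {[]})          _         = [-]
Insert⁻-ordered _          (join {_ ∷ _} {[] ∷ _})      (() ∷ _)
Insert⁻-ordered _          (join {_ ∷ _} {(_ ∷ _) ∷ _}) (b≺c ∷ l) = b≺c ∷ l
Insert⁻-ordered _          (skip new)                   _         = [-]
Insert⁻-ordered (_ ∷ ne@(c≢[] ∷ _)) (skip i) l = ≺-Insert⁻ c≢[] i l ∷ Insert⁻-ordered ne i (Linked.tail l)

concat-Insert : ∀ {m σ π} → Insert m σ π → concat π ↭ m ∷ concat σ
concat-Insert new                 = ↭-refl
concat-Insert {m} (join {b} {bs}) =
  ↭-trans (↭-reflexive (++-assoc b [ m ] (concat bs))) (↭-shift m b (concat bs))
concat-Insert {m} (skip {b} {bs} i) = ↭-trans (++⁺ˡ b (concat-Insert i)) (↭-shift m b (concat bs))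

Insert-injective : ∀ {m σ σ′ π π′} → All (_≢ []) σ → All (_≢ []) σ′ → m ∉ concat σ → m ∉ concat σ′ →
                   Insert m σ π → Insert m σ′ π′ → π ≡ π′ → σ ≡ σ′
Insert-injective _ _ _ _ new new _ = refl
Insert-injective _ (b≢[] ∷ _) _ _ new (join {b}) eq =
  ⊥-elim (b≢[] (sym (∷ʳ-injectiveˡ [] b (∷-injectiveˡ eq))))
Insert-injective _ _ _ m∉σ′ new (skip _) eq =
  ⊥-elim (m∉σ′ (∈-++⁺ˡ (subst (_ ∈_) (∷-injectiveˡ eq) (here refl))))
Insert-injective (b≢[] ∷ _) _ _ _ (join {b}) new eq =
  ⊥-elim (b≢[] (∷ʳ-injectiveˡ b [] (∷-injectiveˡ eq)))
Insert-injective _ _ _ _ (join {b}) (join {b′}) eq =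
  cong₂ _∷_ (∷ʳ-injectiveˡ b b′ (∷-injectiveˡ eq)) (∷-injectiveʳ eq)
Insert-injective _ _ _ m∉σ′ (join {b}) (skip _) eq =
  ⊥-elim (m∉σ′ (∈-++⁺ˡ (subst (_ ∈_) (∷-injectiveˡ eq) (∈-++⁺ʳ b (here refl)))))
Insert-injective _ _ m∉σ _ (skip _) new eq =
  ⊥-elim (m∉σ (∈-++⁺ˡ (subst (_ ∈_) (sym (∷-injectiveˡ eq)) (here refl))))
Insert-injective _ _ m∉σ _ (skip _) (join {b′}) eq =
  ⊥-elim (m∉σ (∈-++⁺ˡ (subst (_ ∈_) (sym (∷-injectiveˡ eq)) (∈-++⁺ʳ b′ (here refl)))))
Insert-injective (_ ∷ ne) (_ ∷ ne′) m∉σ m∉σ′ (skip {b} i) (skip {b′} i′) eq =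
  cong₂ _∷_ (∷-injectiveˡ eq)
            (Insert-injective ne ne′ (m∉σ ∘ ∈-++⁺ʳ b) (m∉σ′ ∘ ∈-++⁺ʳ b′) i i′ (∷-injectiveʳ eq))

max-is-last : ∀ {m} b → Linked _<_ b → All (_≤ m) b → m ∈ b → ∃[ b′ ] b ≡ b′ ∷ʳ m
max-is-last (_ ∷ [])     _         _             (here refl) = [] , refl
max-is-last (_ ∷ _ ∷ _)  (m<y ∷ _) (_ ∷ y≤m ∷ _) (here refl) = ⊥-elim (<-irrefl refl (<-≤-trans m<y y≤m))
max-is-last (x ∷ y ∷ ys) (_ ∷ l)   (_ ∷ bd)      (there m∈) =
  let b′ , eq = max-is-last (y ∷ ys) l bd m∈ in x ∷ b′ , cong (x ∷_) eq

singleton-max-is-last : ∀ {m} bs → Linked _≺_ ([ m ] ∷ bs) → All (_≤ m) (concat bs) → bs ≡ []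
singleton-max-is-last []            _         _         = refl
singleton-max-is-last ([] ∷ _)      (() ∷ _)  _
singleton-max-is-last ((_ ∷ _) ∷ _) (m<y ∷ _) (y≤m ∷ _) = ⊥-elim (<-irrefl refl (<-≤-trans m<y y≤m))

remove-max : ∀ {m} π → All (_≢ []) π → All (Linked _<_) π → Linked _≺_ π →
             All (_≤ m) (concat π) → m ∈ concat π → ∃[ σ ] All (_≢ []) σ × Insert m σ π
remove-max {m} (b ∷ bs) (b≢[] ∷ ne) (b↑ ∷ bs↑) l bd m∈ with ∈-++⁻ b m∈
... | inj₂ m∈bs =
  let σ , σ≢[] , i = remove-max bs ne bs↑ (Linked.tail l) (++⁻ʳ b bd) m∈bs
  in  b ∷ σ , b≢[] ∷ σ≢[] , skip i
... | inj₁ m∈b with max-is-last b b↑ (++⁻ˡ b bd) m∈b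
...   | y ∷ ys , refl = (y ∷ ys) ∷ bs , (λ ()) ∷ ne , join
...   | []     , refl with refl ← singleton-max-is-last bs l (++⁻ʳ [ m ] bd) = [] , [] , new

-- Set partitions of {1,…,n+1} versus those of {1,…,n}

range1-suc : ∀ n → range1 (suc n) ↭ suc n ∷ range1 n
range1-suc n = begin
  map suc (upTo (suc n)) ≡⟨ cong (map suc) (upTo-∷ʳ n) ⟨
  map suc (upTo n ∷ʳ n)  ≡⟨ map-++ suc (upTo n) [ n ] ⟩
  range1 n ∷ʳ suc n      ↭⟨ ∷↭∷ʳ (suc n) (range1 n) ⟨
  suc n ∷ range1 n       ∎
  where open PermutationReasoning

suc∈range1 : ∀ n → suc n ∈ range1 (suc n)
suc∈range1 n = ∈-resp-↭ (↭-sym (range1-suc n)) (here refl)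

range1-bounded : ∀ n → All (_≤ n) (range1 n)
range1-bounded n = map⁺ (All.tabulate ∈-upTo⁻)

size≡length∘concat : ∀ π → size π ≡ length (concat π)
size≡length∘concat []       = refl
size≡length∘concat (b ∷ bs) = trans (cong (length b ℕ.+_) (size≡length∘concat bs)) (sym (length-++ b))

module _ {n} π (perm : concat π ↭ range1 n) where

  size-↭range1 : size π ≡ n
  size-↭range1 = begin
    size π            ≡⟨ size≡length∘concat π ⟩
    length (concat π) ≡⟨ ↭-length perm ⟩
    length (range1 n) ≡⟨ length-map suc (upTo n) ⟩
    length (upTo n)   ≡⟨ length-upTo n ⟩
    n                 ∎
    where open ≡-Reasoning

  concat-bounded : All (_≤ n) (concat π)
  concat-bounded = All-resp-↭ (↭-sym perm) (range1-bounded n)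

  suc-fresh : suc n ∉ concat π
  suc-fresh m∈ = <-irrefl refl (All.lookup concat-bounded m∈)

Insert-IsSetPartition⁺ : ∀ {n σ π} → IsSetPartition n σ → Insert (suc n) σ π → IsSetPartition (suc n) π
Insert-IsSetPartition⁺ {n} {σ} (ne , σ↑ , l , perm) i =
  Insert-nonempty ne i , Insert-increasing σ↑ bd i , Insert-ordered ne bd i l ,
  ↭-trans (concat-Insert i) (↭-trans (↭-prep (suc n) perm) (↭-sym (range1-suc n)))
  where
  bd : All (_< suc n) (concat σ)
  bd = All.map s≤s (concat-bounded σ perm)

Insert-IsSetPartition⁻ : ∀ {n π} → IsSetPartition (suc n) π →
                         ∃[ σ ] IsSetPartition n σ × Insert (suc n) σ π
Insert-IsSetPartition⁻ {n} {π} (ne , π↑ , l , perm)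
  with σ , σ≢[] , i ← remove-max π ne π↑ l (concat-bounded π perm) (∈-resp-↭ (↭-sym perm) (suc∈range1 n))
  = σ , (σ≢[] , Insert⁻-increasing i π↑ , Insert⁻-ordered σ≢[] i l , perm′) , i
  where
  perm′ : concat σ ↭ range1 n
  perm′ = drop-∷ (↭-trans (↭-sym (concat-Insert i)) (↭-trans perm (range1-suc n)))

extensions : Blocks → List Blocks
extensions σ = insertions (suc (size σ)) σ

setPartitions-suc : ∀ n → setPartitions (suc n) ↭ concatMap extensions (setPartitions n)
setPartitions-suc n = ↭-trans (map++concatMap↭ _ ∂Φ (setPartitions n))
                              (↭-reflexive (concatMap-cong T-terms (setPartitions n)))
  where
  T-terms : ∀ σ → mulΦ σ Φ₁ ∷ ∂Φ σ ≡ extensions σ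
  T-terms σ = cong (λ m → (σ ∷ʳ [ m ]) ∷ ∂Φ σ) (+-comm (size σ) 1)

∈extensions⇒Insert : ∀ {n σ π} → size σ ≡ n → π ∈ extensions σ → Insert (suc n) σ π
∈extensions⇒Insert refl = ∈insertions⇒Insert

Insert⇒∈extensions : ∀ {n σ π} → size σ ≡ n → Insert (suc n) σ π → π ∈ extensions σ
Insert⇒∈extensions refl = Insert⇒∈insertions

setPartitions-sound : ∀ n {π} → π ∈ setPartitions n → IsSetPartition n π
setPartitions-sound zero    (here refl) = [] , [] , [] , ↭-refl
setPartitions-sound (suc n) π∈
  with σ , σ∈ , π∈extσ ← find (∈-concatMap⁻ extensions (∈-resp-↭ (setPartitions-suc n) π∈)) =
  let σ-part@(_ , _ , _ , perm) = setPartitions-sound n σ∈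
  in  Insert-IsSetPartition⁺ σ-part (∈extensions⇒Insert (size-↭range1 σ perm) π∈extσ)

setPartitions-complete : ∀ n {π} → IsSetPartition n π → π ∈ setPartitions n
setPartitions-complete zero {[]}     _                           = here refl
setPartitions-complete zero {b ∷ bs} (b≢[] ∷ _ , _ , _ , perm) =
  ⊥-elim (b≢[] (++-conicalˡ b (concat bs) (↭-empty-inv perm)))
setPartitions-complete (suc n) π-part
  with σ , σ-part@(_ , _ , _ , perm) , i ← Insert-IsSetPartition⁻ π-part =
  ∈-resp-↭ (↭-sym (setPartitions-suc n)) (∈-concatMap⁺ extensions
    (lose (setPartitions-complete n σ-part) (Insert⇒∈extensions (size-↭range1 σ perm) i)))

setPartitions-unique : ∀ n → Unique (setPartitions n)
setPartitions-unique zero    = [] ∷ []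
setPartitions-unique (suc n) =
  Unique-resp-↭ (setoid Blocks) (↭⇒↭ₛ (↭-sym (setPartitions-suc n)))
    (unique-concatMap⁺ extensions (setPartitions-unique n) (λ σ → insertions-unique _ σ) same-source)
  where
  same-source : ∀ {σ σ′ π} → σ ∈ setPartitions n → σ′ ∈ setPartitions n →
                π ∈ extensions σ → π ∈ extensions σ′ → σ ≡ σ′
  same-source {σ} {σ′} σ∈ σ′∈ π∈ π∈′
    with ne , _ , _ , perm ← setPartitions-sound n σ∈ | ne′ , _ , _ , perm′ ← setPartitions-sound n σ′∈ =
    Insert-injective ne ne′ (suc-fresh σ perm) (suc-fresh σ′ perm′)
      (∈extensions⇒Insert (size-↭range1 σ perm) π∈) (∈extensions⇒Insert (size-↭range1 σ′ perm′) π∈′) refl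

mainTheorem9 : (n k : ℕ) (π : Blocks) →
    ((IsSetPartition n π × length π ≡ k) → 𝔅coeff n k π ≡ 1ℤ) ×
    (¬ (IsSetPartition n π × length π ≡ k) → 𝔅coeff n k π ≡ 0ℤ)
mainTheorem9 n k π = present , absent
  where
  𝔅coeff-monomials : 𝔅coeff n k π ≡ coeff (map monomial (setPartitions n)) k π
  𝔅coeff-monomials = cong (λ x → coeff x k π) (T^n-one n)

  present : IsSetPartition n π × length π ≡ k → 𝔅coeff n k π ≡ 1ℤ
  present (π-part , refl) = trans 𝔅coeff-monomials
    (coeff-monomials-∈ (setPartitions-unique n) (setPartitions-complete n π-part))

  absent : ¬ (IsSetPartition n π × length π ≡ k) → 𝔅coeff n k π ≡ 0ℤ
  absent ¬π-part = trans 𝔅coeff-monomials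
    (coeff-monomials-∉ _ λ (π∈ , |π|≡k) → ¬π-part (setPartitions-sound n π∈ , |π|≡k))
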